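{- For every integer $n\geq1$, let $f(n)=\sum_{d \mid n} \frac{d}{P^{+}(d)}$, the sum over all positive divisors $d$ of $n$. Then $f(n) \leq n$ for every integer $n \geq 1$.
   Context: $P^+(d)$ denotes the largest prime divisor of $d$, with the convention $P^+(1)=1$. -}

module Defs where

open import Data.Nat using (ℕ; zero; suc; _+_; _⊔_; NonZero; _/_)
open import Data.Nat.Divisibility using (_∣_; _∣?_)
open import Data.Nat.Primality using (Prime; prime?)
open import Data.List using (List; []; _∷_; filter; upTo; map; foldr)
open import Data.Nat.ListAction using (sum)
open import Relation.Nullary.Decidable using (_×-dec_)

-- positive divisors of n, i.e. the list of d with 1 ≤ d ≤ n and d ∣ n
-- (upTo n = [0,…,n-1], so map suc (upTo n) = [1,…,n])
divisors : ℕ → List ℕ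
divisors n = filter (λ d → d ∣? n) (map suc (upTo n))

-- P⁺ d : the largest prime divisor of d, with P⁺ 1 = 1
-- (maximum of 1 and all primes p ≤ d with p ∣ d; for d ≥ 1 every prime
--  divisor of d is ≤ d, so this is exactly the largest prime divisor)
P⁺ : ℕ → ℕ
P⁺ d = foldr _⊔_ 1 (filter (λ p → prime? p ×-dec (p ∣? d)) (upTo (suc d)))

P⁺-nonZero : ∀ d → NonZero (P⁺ d)
P⁺-nonZero d = go (filter (λ p → prime? p ×-dec (p ∣? d)) (upTo (suc d)))
  where
  open import Data.Nat.Properties using (m≤n⇒m≤o⊔n; ≤-refl)
  open import Data.Nat using (_≤_; s≤s; z≤n; >-nonZero)
  go : (xs : List ℕ) → NonZero (foldr _⊔_ 1 xs)
  go [] = _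
  go (x ∷ xs) = >-nonZero (m≤n⇒m≤o⊔n x (lemma xs))
    where
    lemma : (ys : List ℕ) → 1 ≤ foldr _⊔_ 1 ys
    lemma [] = s≤s z≤n
    lemma (y ∷ ys) = m≤n⇒m≤o⊔n y (lemma ys)

term : ℕ → ℕ
term d = _/_ d (P⁺ d) {{P⁺-nonZero d}}

f : ℕ → ℕ
f n = sum (map term (divisors n))

module Submission where

-- Write n = N q with q = P⁺ n. A divisor of n either divides N, or is d q with d ∣ N and
-- q ∤ N/d; in the latter case P⁺ (d q) = q, so it contributes d. Hence
-- f (N q) = f N + σ⊥ q N, where σ⊥ q N sums the divisors d of N with q ∤ N/d, and by
-- induction it suffices that σ⊥ p N ≤ (p − 1) N whenever every prime factor of N is ≤ p.
-- This follows by the same splitting N = N′ q: if q = p then σ⊥ p N = p σ⊥ p N′, and if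
-- q < p then σ⊥ p N = σ N = σ⊥ p N′ + q σ⊥ q N′ ≤ (p − 1) N′ + q (q − 1) N′ ≤ (p − 1) N.

open import Data.Empty using (⊥-elim)
open import Data.List using (List; []; _∷_; [_]; _++_; filter; upTo; map)
open import Data.List.Membership.Propositional using (_∈_)
open import Data.List.Membership.Propositional.Properties
  using (∈-filter⁺; ∈-filter⁻; ∈-upTo⁺; foldr-selective)
open import Data.List.Properties using (map-++; upTo-∷ʳ; foldr-preservesᵒ)
open import Data.List.Relation.Unary.All using (_∷_)
import Data.List.Relation.Unary.Any as Any
open import Data.Nat
open import Data.Nat.DivMod using (m*n/n≡m; /-congʳ)
open import Data.Nat.Divisibility
open import Data.Nat.Induction using (<-wellFounded)
open import Data.Nat.ListAction using (sum; product)
open import Data.Nat.ListAction.Properties using (sum-++)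
open import Data.Nat.Primality
open import Data.Nat.Primality.Factorisation using (factorise)
open import Data.Nat.Properties
open import Algebra.Properties.CommutativeSemigroup Data.Nat.Properties.+-commutativeSemigroup
  using () renaming (interchange to +-interchange)
open import Data.Product using (∃-syntax; _×_; _,_; proj₁; proj₂)
open import Data.Sum using (_⊎_; inj₁; inj₂; [_,_]′)
open import Induction.WellFounded using (Acc; acc)
open import Relation.Binary.PropositionalEquality hiding ([_])
open import Relation.Nullary using (Dec; yes; no; ¬_)
open import Relation.Nullary.Decidable using (_×-dec_; ¬?)
open import Relation.Unary using (Decidable)

open import Defs

sumTo : ℕ → (ℕ → ℕ) → ℕ
sumTo zero    F = 0
sumTo (suc n) F = sumTo n F + F (suc n)

sumTo-cong : ∀ n {F G : ℕ → ℕ} → (∀ {i} → 1 ≤ i → i ≤ n → F i ≡ G i) →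
             sumTo n F ≡ sumTo n G
sumTo-cong zero    F≗G = refl
sumTo-cong (suc n) F≗G =
  cong₂ _+_ (sumTo-cong n (λ 1≤i i≤n → F≗G 1≤i (m≤n⇒m≤1+n i≤n))) (F≗G z<s ≤-refl)

sumTo-vanishing : ∀ n {F : ℕ → ℕ} → (∀ {i} → 1 ≤ i → i ≤ n → F i ≡ 0) → sumTo n F ≡ 0
sumTo-vanishing n F≗0 = trans (sumTo-cong n F≗0) (zeros n)
  where
  zeros : ∀ n → sumTo n (λ _ → 0) ≡ 0
  zeros zero    = refl
  zeros (suc n) = cong (_+ 0) (zeros n)

sumTo-+ : ∀ n (F G : ℕ → ℕ) → sumTo n (λ i → F i + G i) ≡ sumTo n F + sumTo n G
sumTo-+ zero    F G = refl
sumTo-+ (suc n) F G = begin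
  sumTo n (λ i → F i + G i) + (F (suc n) + G (suc n))
    ≡⟨ cong (_+ (F (suc n) + G (suc n))) (sumTo-+ n F G) ⟩
  sumTo n F + sumTo n G + (F (suc n) + G (suc n))
    ≡⟨ +-interchange (sumTo n F) (sumTo n G) (F (suc n)) (G (suc n)) ⟩
  sumTo n F + F (suc n) + (sumTo n G + G (suc n)) ∎
  where open ≡-Reasoning

sumTo-*ʳ : ∀ n (F : ℕ → ℕ) c → sumTo n (λ i → F i * c) ≡ sumTo n F * c
sumTo-*ʳ zero    F c = refl
sumTo-*ʳ (suc n) F c =
  trans (cong (_+ F (suc n) * c) (sumTo-*ʳ n F c)) (sym (*-distribʳ-+ c (sumTo n F) (F (suc n))))

sumTo-+-range : ∀ m k (F : ℕ → ℕ) → sumTo (m + k) F ≡ sumTo m F + sumTo k (λ i → F (m + i))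
sumTo-+-range m zero    F rewrite +-identityʳ m = sym (+-identityʳ _)
sumTo-+-range m (suc k) F rewrite +-suc m k | sumTo-+-range m k F =
  +-assoc (sumTo m F) (sumTo k (λ i → F (m + i))) (F (suc (m + k)))

sumTo-tail : ∀ {m n} (F : ℕ → ℕ) → m ≤ n → (∀ {i} → m < i → F i ≡ 0) → sumTo n F ≡ sumTo m F
sumTo-tail {m} F m≤n F≗0 with m≤n⇒∃[o]m+o≡n m≤n
... | k , refl = begin
  sumTo (m + k) F                              ≡⟨ sumTo-+-range m k F ⟩
  sumTo m F + sumTo k (λ i → F (m + i))        ≡⟨ cong (sumTo m F +_) (sumTo-vanishing k tail≗0) ⟩
  sumTo m F + 0                                ≡⟨ +-identityʳ _ ⟩
  sumTo m F                                    ∎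
  where
  open ≡-Reasoning
  tail≗0 : ∀ {i} → 1 ≤ i → i ≤ k → F (m + i) ≡ 0
  tail≗0 1≤i _ = F≗0 (m<m+n m 1≤i)

sumTo-multiples : ∀ q .{{_ : NonZero q}} N (G : ℕ → ℕ) → (∀ {i} → ¬ q ∣ i → G i ≡ 0) →
                  sumTo (N * q) G ≡ sumTo N (λ j → G (j * q))
sumTo-multiples q           zero    G G≗0 = refl
sumTo-multiples q@(suc q′) (suc N) G G≗0 = begin
  sumTo (q + N * q) G
    ≡⟨ cong (λ M → sumTo M G) (+-comm q (N * q)) ⟩
  sumTo (N * q + q) G
    ≡⟨ sumTo-+-range (N * q) q G ⟩
  sumTo (N * q) G + (sumTo q′ (λ i → G (N * q + i)) + G (N * q + q))
    ≡⟨ cong₂ _+_ (sumTo-multiples q N G G≗0)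
                 (cong₂ _+_ (sumTo-vanishing q′ gap≗0) (cong G (+-comm (N * q) q))) ⟩
  sumTo N (λ j → G (j * q)) + G (q + N * q) ∎
  where
  open ≡-Reasoning
  gap≗0 : ∀ {i} → 1 ≤ i → i ≤ q′ → G (N * q + i) ≡ 0
  gap≗0 {i} 1≤i i≤q′ = G≗0 λ q∣ → <⇒≱ (s≤s i≤q′) (∣⇒≤ {{>-nonZero 1≤i}} (∣m+n∣m⇒∣n q∣ (n∣m*n N)))

when : ∀ {a} {A : Set a} → Dec A → ℕ → ℕ
when (yes _) x = x
when (no _)  _ = 0

module _ {a} {A : Set a} where

  when-yes : (A? : Dec A) {x : ℕ} → A → when A? x ≡ x
  when-yes (yes _) _ = refl
  when-yes (no ¬A) A = ⊥-elim (¬A A)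

  when-no : (A? : Dec A) {x : ℕ} → ¬ A → when A? x ≡ 0
  when-no (yes A) ¬A = ⊥-elim (¬A A)
  when-no (no _)  _  = refl

  when-cong : (A? : Dec A) {x y : ℕ} → (A → x ≡ y) → when A? x ≡ when A? y
  when-cong (yes A) x≡y = x≡y A
  when-cong (no _)  _   = refl

  when-zero : (A? : Dec A) → when A? 0 ≡ 0
  when-zero (yes _) = refl
  when-zero (no _)  = refl

  when-*ʳ : (A? : Dec A) (x c : ℕ) → when A? (x * c) ≡ when A? x * c
  when-*ʳ (yes _) x c = refl
  when-*ʳ (no _)  x c = refl

sum-map-filter : ∀ {p} {P : ℕ → Set p} (P? : Decidable P) (g : ℕ → ℕ) xs →
                 sum (map g (filter P? xs)) ≡ sum (map (λ x → when (P? x) (g x)) xs)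
sum-map-filter P? g []       = refl
sum-map-filter P? g (x ∷ xs) with P? x
... | yes _ = cong (g x +_) (sum-map-filter P? g xs)
... | no _  = sum-map-filter P? g xs

sum-map-upTo-suc : ∀ (F : ℕ → ℕ) n → sum (map F (map suc (upTo n))) ≡ sumTo n F
sum-map-upTo-suc F zero    = refl
sum-map-upTo-suc F (suc n) = begin
  sum (map F (map suc (upTo (suc n))))
    ≡⟨ cong (λ xs → sum (map F (map suc xs))) (sym (upTo-∷ʳ n)) ⟩
  sum (map F (map suc (upTo n ++ [ n ])))
    ≡⟨ cong (λ xs → sum (map F xs)) (map-++ suc (upTo n) [ n ]) ⟩
  sum (map F (map suc (upTo n) ++ [ suc n ]))
    ≡⟨ cong sum (map-++ F (map suc (upTo n)) [ suc n ]) ⟩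
  sum (map F (map suc (upTo n)) ++ [ F (suc n) ])
    ≡⟨ sum-++ (map F (map suc (upTo n))) [ F (suc n) ] ⟩
  sum (map F (map suc (upTo n))) + (F (suc n) + 0)
    ≡⟨ cong₂ _+_ (sum-map-upTo-suc F n) (+-identityʳ (F (suc n))) ⟩
  sumTo n F + F (suc n) ∎
  where open ≡-Reasoning

divisorSum : ℕ → (ℕ → ℕ) → ℕ
divisorSum N g = sumTo N (λ d → when (d ∣? N) (g d))

divisorSum⊥ : ℕ → ℕ → (ℕ → ℕ) → ℕ
divisorSum⊥ q N g = divisorSum N (λ d → when (¬? (d * q ∣? N)) (g d))

divisorSum-cong : ∀ N {g h : ℕ → ℕ} → (∀ {d} → d ∣ N → g d ≡ h d) →
                  divisorSum N g ≡ divisorSum N h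
divisorSum-cong N g≗h = sumTo-cong N λ {d} _ _ → when-cong (d ∣? N) g≗h

divisorSum-vanishing : ∀ N {g : ℕ → ℕ} → (∀ {d} → d ∣ N → g d ≡ 0) → divisorSum N g ≡ 0
divisorSum-vanishing N g≗0 =
  sumTo-vanishing N λ {d} _ _ → trans (when-cong (d ∣? N) g≗0) (when-zero (d ∣? N))

divisorSum⊥-cong : ∀ q N {g h : ℕ → ℕ} → (∀ {d} → d ∣ N → ¬ d * q ∣ N → g d ≡ h d) →
                   divisorSum⊥ q N g ≡ divisorSum⊥ q N h
divisorSum⊥-cong q N g≗h = divisorSum-cong N λ {d} d∣N → when-cong (¬? (d * q ∣? N)) (g≗h d∣N)

divisorSum⊥-*ʳ : ∀ q N (g : ℕ → ℕ) c →
                 divisorSum⊥ q N (λ d → g d * c) ≡ divisorSum⊥ q N g * c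
divisorSum⊥-*ʳ q N g c = trans (sumTo-cong N λ {d} _ _ → scale d) (sumTo-*ʳ N _ c)
  where
  scale : ∀ d → when (d ∣? N) (when (¬? (d * q ∣? N)) (g d * c))
              ≡ when (d ∣? N) (when (¬? (d * q ∣? N)) (g d)) * c
  scale d = trans (cong (when (d ∣? N)) (when-*ʳ (¬? (d * q ∣? N)) (g d) c))
                  (when-*ʳ (d ∣? N) _ c)

∣n*p∧∤n⇒p∣ : ∀ {d n p} → Prime p → d ∣ n * p → ¬ d ∣ n → p ∣ d
∣n*p∧∤n⇒p∣ {d} {n} {p} pr (divides k n*p≡k*d) d∤n
  with euclidsLemma k d pr (divides n (sym n*p≡k*d))
... | inj₂ p∣d = p∣d
... | inj₁ (divides k′ refl) =
  ⊥-elim (d∤n (divides k′ (*-cancelʳ-≡ n (k′ * d) p {{prime⇒nonZero pr}} n*p≡k′*d*p)))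
  where
  n*p≡k′*d*p : n * p ≡ k′ * d * p
  n*p≡k′*d*p = begin
    n * p         ≡⟨ n*p≡k*d ⟩
    k′ * p * d    ≡⟨ *-assoc k′ p d ⟩
    k′ * (p * d)  ≡⟨ cong (k′ *_) (*-comm p d) ⟩
    k′ * (d * p)  ≡⟨ *-assoc k′ d p ⟨
    k′ * d * p    ∎
    where open ≡-Reasoning

divisorSum-*prime : ∀ {q} N (g : ℕ → ℕ) → Prime q → 1 ≤ N →
                    divisorSum (N * q) g ≡ divisorSum N g + divisorSum⊥ q N (λ d → g (d * q))
divisorSum-*prime {q} N g pr 1≤N = begin
  divisorSum (N * q) g
    ≡⟨ sumTo-cong (N * q) (λ {d} _ _ → old+new d) ⟩
  sumTo (N * q) (λ d → old d + new d)
    ≡⟨ sumTo-+ (N * q) old new ⟩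
  sumTo (N * q) old + sumTo (N * q) new
    ≡⟨ cong₂ _+_ (sumTo-tail old (m≤m*n N q) old-tail) (sumTo-multiples q N new new-off-multiples) ⟩
  divisorSum N g + sumTo N (λ j → new (j * q))
    ≡⟨ cong (divisorSum N g +_) (sumTo-cong N (λ {j} _ _ → new-multiple j)) ⟩
  divisorSum N g + divisorSum⊥ q N (λ d → g (d * q)) ∎
  where
  open ≡-Reasoning
  instance
    q≢0 : NonZero q
    q≢0 = prime⇒nonZero pr
  old new : ℕ → ℕ
  old d = when (d ∣? N) (g d)
  new d = when (¬? (d ∣? N)) (when (d ∣? N * q) (g d))

  old+new : ∀ d → when (d ∣? N * q) (g d) ≡ old d + new d
  old+new d with d ∣? N | d ∣? N * q
  ... | yes _   | yes _     = sym (+-identityʳ (g d))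
  ... | yes d∣N | no d∤N*q  = ⊥-elim (d∤N*q (∣-trans d∣N (m∣m*n q)))
  ... | no _    | _         = refl

  old-tail : ∀ {d} → N < d → old d ≡ 0
  old-tail {d} N<d = when-no (d ∣? N) λ d∣N → <⇒≱ N<d (∣⇒≤ {{>-nonZero 1≤N}} d∣N)

  new-off-multiples : ∀ {d} → ¬ q ∣ d → new d ≡ 0
  new-off-multiples {d} q∤d with d ∣? N
  ... | yes _   = refl
  ... | no  d∤N = when-no (d ∣? N * q) λ d∣N*q → q∤d (∣n*p∧∤n⇒p∣ pr d∣N*q d∤N)

  new-multiple : ∀ j → new (j * q) ≡ when (j ∣? N) (when (¬? (j * q ∣? N)) (g (j * q)))
  new-multiple j with j ∣? N | j * q ∣? N * q | j * q ∣? N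
  ... | yes j∣N | no jq∤Nq | _       = ⊥-elim (jq∤Nq (*-monoˡ-∣ q j∣N))
  ... | no j∤N  | yes jq∣Nq | _      = ⊥-elim (j∤N (*-cancelʳ-∣ q jq∣Nq))
  ... | yes _   | yes _    | yes _   = refl
  ... | yes _   | yes _    | no _    = refl
  ... | no _    | no _     | yes _   = refl
  ... | no _    | no _     | no _    = refl

σ : ℕ → ℕ
σ N = divisorSum N (λ d → d)

σ⊥ : ℕ → ℕ → ℕ
σ⊥ q N = divisorSum⊥ q N (λ d → d)

σ⊥-coprime : ∀ {p N} → ¬ p ∣ N → σ⊥ p N ≡ σ N
σ⊥-coprime {p} {N} p∤N =
  divisorSum-cong N λ {d} _ → when-yes (¬? (d * p ∣? N)) λ d*p∣N → p∤N (m*n∣⇒n∣ d p d*p∣N)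

σ-*prime : ∀ {q} N → Prime q → 1 ≤ N → σ (N * q) ≡ σ N + σ⊥ q N * q
σ-*prime {q} N pr 1≤N = trans (divisorSum-*prime N (λ d → d) pr 1≤N)
                              (cong (σ N +_) (divisorSum⊥-*ʳ q N (λ d → d) q))

σ⊥-*self : ∀ {p} N → Prime p → 1 ≤ N → σ⊥ p (N * p) ≡ σ⊥ p N * p
σ⊥-*self {p} N pr 1≤N = begin
  σ⊥ p (N * p)
    ≡⟨ divisorSum-*prime N _ pr 1≤N ⟩
  divisorSum N (λ d → when (¬? (d * p ∣? N * p)) d)
    + divisorSum⊥ p N (λ d → when (¬? (d * p * p ∣? N * p)) (d * p))
    ≡⟨ cong₂ _+_ (divisorSum-vanishing N old≗0) (divisorSum⊥-cong p N new≗d*p) ⟩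
  divisorSum⊥ p N (λ d → d * p)
    ≡⟨ divisorSum⊥-*ʳ p N (λ d → d) p ⟩
  σ⊥ p N * p ∎
  where
  open ≡-Reasoning
  instance
    p≢0 : NonZero p
    p≢0 = prime⇒nonZero pr
  old≗0 : ∀ {d} → d ∣ N → when (¬? (d * p ∣? N * p)) d ≡ 0
  old≗0 {d} d∣N = when-no (¬? (d * p ∣? N * p)) λ d*p∤N*p → d*p∤N*p (*-monoˡ-∣ p d∣N)
  new≗d*p : ∀ {d} → d ∣ N → ¬ d * p ∣ N → when (¬? (d * p * p ∣? N * p)) (d * p) ≡ d * p
  new≗d*p {d} _ d*p∤N =
    when-yes (¬? (d * p * p ∣? N * p)) λ d*p*p∣N*p → d*p∤N (*-cancelʳ-∣ p d*p*p∣N*p)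

Smooth : ℕ → ℕ → Set
Smooth p N = ∀ {r} → Prime r → r ∣ N → r ≤ p

smooth-∣ : ∀ {p m N} → m ∣ N → Smooth p N → Smooth p m
smooth-∣ m∣N smooth pr r∣m = smooth pr (∣-trans r∣m m∣N)

smooth-*prime : ∀ {q N} → Prime q → Smooth q N → Smooth q (N * q)
smooth-*prime {q} {N} prq smooth {r} pr r∣N*q with euclidsLemma N q pr r∣N*q
... | inj₁ r∣N = smooth pr r∣N
... | inj₂ r∣q = ∣⇒≤ {{prime⇒nonZero prq}} r∣q

prime⇒≥2 : ∀ {p} → Prime p → 2 ≤ p
prime⇒≥2 {p} pr = nonTrivial⇒n>1 p {{prime⇒nonTrivial pr}}

primeDivisor : ∀ {n} → 2 ≤ n → ∃[ p ] Prime p × p ∣ n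
primeDivisor {1} (s≤s ())
primeDivisor {n@(2+ _)} _ with factorise n
... | record { factors = [] ; isFactorisation = () }
... | record { factors = p ∷ ps ; isFactorisation = n≡p*Πps ; factorsPrime = pr ∷ _ } =
  p , pr , divides (product ps) (trans n≡p*Πps (*-comm p (product ps)))

primeDivisorList : ℕ → List ℕ
primeDivisorList d = filter (λ p → prime? p ×-dec (p ∣? d)) (upTo (suc d))

smooth-P⁺ : ∀ {d} → 1 ≤ d → Smooth (P⁺ d) d
smooth-P⁺ {d} 1≤d {r} pr r∣d =
  foldr-preservesᵒ ≤-⊔ 1 (primeDivisorList d) (inj₂ (Any.map ≤-reflexive r∈))
  where
  ≤-⊔ : ∀ x y → r ≤ x ⊎ r ≤ y → r ≤ x ⊔ y
  ≤-⊔ x y = [ m≤n⇒m≤n⊔o y , m≤n⇒m≤o⊔n x ]′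
  r∈ : r ∈ primeDivisorList d
  r∈ = ∈-filter⁺ (λ p → prime? p ×-dec (p ∣? d))
                 (∈-upTo⁺ (s≤s (∣⇒≤ {{>-nonZero 1≤d}} r∣d))) (pr , r∣d)

P⁺-prime-∣ : ∀ {d} → 2 ≤ d → Prime (P⁺ d) × P⁺ d ∣ d
P⁺-prime-∣ {d} 2≤d with foldr-selective ⊔-sel 1 (primeDivisorList d)
... | inj₂ P⁺∈ = proj₂ (∈-filter⁻ (λ p → prime? p ×-dec (p ∣? d)) {xs = upTo (suc d)} P⁺∈)
... | inj₁ P⁺≡1 with primeDivisor 2≤d
...   | r , pr , r∣d =
  ⊥-elim (<⇒≱ (prime⇒≥2 pr) (subst (r ≤_) P⁺≡1 (smooth-P⁺ (≤-trans (s≤s z≤n) 2≤d) pr r∣d)))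

P⁺-*prime : ∀ {q d} → Prime q → Smooth q d → 1 ≤ d → P⁺ (d * q) ≡ q
P⁺-*prime {q} {d} prq smooth 1≤d =
  ≤-antisym (smooth-*prime prq smooth (proj₁ (P⁺-prime-∣ 2≤d*q)) (proj₂ (P⁺-prime-∣ 2≤d*q)))
            (smooth-P⁺ (≤-trans (s≤s z≤n) 2≤d*q) prq (n∣m*n d))
  where
  2≤d*q : 2 ≤ d * q
  2≤d*q = ≤-trans (prime⇒≥2 prq) (m≤n*m q d {{>-nonZero 1≤d}})

term-*prime : ∀ {q d} → Prime q → Smooth q d → 1 ≤ d → term (d * q) ≡ d
term-*prime {q} {d} prq smooth 1≤d = begin
  term (d * q)  ≡⟨ /-congʳ {{P⁺-nonZero (d * q)}} (P⁺-*prime prq smooth 1≤d) ⟩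
  d * q / q     ≡⟨ m*n/n≡m d q ⟩
  d             ∎
  where
  open ≡-Reasoning
  instance
    q≢0 : NonZero q
    q≢0 = prime⇒nonZero prq

-- Strong induction on N, splitting off its largest prime factor P⁺ N.
smooth-induction : ∀ {ℓ} (P : ℕ → Set ℓ) → P 1 →
                   (∀ {N q} → Prime q → Smooth q N → 1 ≤ N → P N → P (N * q)) →
                   ∀ {N} → 1 ≤ N → P N
smooth-induction P base step {N} = go N (<-wellFounded N)
  where
  go : ∀ N → Acc _<_ N → 1 ≤ N → P N
  go 1            _         _   = base
  go N@(2+ _) (acc rec) 1≤N with P⁺-prime-∣ {N} (s≤s (s≤s z≤n))
  ... | prq , q∣N = subst P (sym N≡N′*q) (step prq smooth 1≤N′ (go N′ (rec N′<N) 1≤N′))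
    where
    N′ = quotient q∣N
    N≡N′*q : N ≡ N′ * P⁺ N
    N≡N′*q = m∣n⇒n≡quotient*m q∣N
    1≤N′ : 1 ≤ N′
    1≤N′ = >-nonZero⁻¹ N′ {{quotient≢0 q∣N}}
    N′<N : N′ < N
    N′<N = quotient-< q∣N {{prime⇒nonTrivial prq}}
    smooth : Smooth (P⁺ N) N′
    smooth = smooth-∣ (quotient-∣ q∣N) (smooth-P⁺ 1≤N)

1+o≤m⇒m*n+o*n*[1+o]≤m*[n*[1+o]] : ∀ m n {o} → suc o ≤ m → m * n + o * n * suc o ≤ m * (n * suc o)
1+o≤m⇒m*n+o*n*[1+o]≤m*[n*[1+o]] m n {o} 1+o≤m = begin
  m * n + o * n * suc o   ≡⟨ cong (m * n +_) (*-comm (o * n) (suc o)) ⟩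
  m * n + suc o * (o * n) ≡⟨ cong (m * n +_) (*-assoc (suc o) o n) ⟨
  m * n + suc o * o * n   ≤⟨ +-monoʳ-≤ (m * n) (*-monoˡ-≤ n (*-monoˡ-≤ o 1+o≤m)) ⟩
  m * n + m * o * n       ≡⟨ *-distribʳ-+ n m (m * o) ⟨
  (m + m * o) * n         ≡⟨ cong (_* n) (*-suc m o) ⟨
  m * suc o * n           ≡⟨ *-assoc m (suc o) n ⟩
  m * (suc o * n)         ≡⟨ cong (m *_) (*-comm (suc o) n) ⟩
  m * (n * suc o)         ∎
  where open ≤-Reasoning

σ⊥-bound : ∀ {N} → 1 ≤ N → ∀ {p} → Prime (suc p) → Smooth (suc p) N → σ⊥ (suc p) N ≤ p * N
σ⊥-bound = smooth-induction Bound base step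
  where
  Bound : ℕ → Set
  Bound N = ∀ {p} → Prime (suc p) → Smooth (suc p) N → σ⊥ (suc p) N ≤ p * N

  base : Bound 1
  base {p} pr _ = begin
    σ⊥ (suc p) 1  ≡⟨ σ⊥-coprime (λ p∣1 → <⇒≢ (prime⇒≥2 pr) (sym (∣1⇒≡1 p∣1))) ⟩
    1             ≤⟨ s≤s⁻¹ (prime⇒≥2 pr) ⟩
    p             ≡⟨ *-identityʳ p ⟨
    p * 1         ∎
    where open ≤-Reasoning

  step : ∀ {N q} → Prime q → Smooth q N → 1 ≤ N → Bound N → Bound (N * q)
  step {N} {q = q@(suc q′)} prq smoothN 1≤N bound {p} prp smoothNq with suc p ∣? N * q
  ... | yes p∣Nq = subst (λ r → σ⊥ (suc p) (N * r) ≤ p * (N * r)) (sym q≡p) (begin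
      σ⊥ (suc p) (N * suc p)    ≡⟨ σ⊥-*self N prp 1≤N ⟩
      σ⊥ (suc p) N * suc p      ≤⟨ *-monoˡ-≤ (suc p) (bound prp (smooth-∣ (m∣m*n q) smoothNq)) ⟩
      p * N * suc p             ≡⟨ *-assoc p N (suc p) ⟩
      p * (N * suc p)           ∎)
    where
    open ≤-Reasoning
    q≡p : q ≡ suc p
    q≡p = ≤-antisym (smoothNq prq (n∣m*n N)) (smooth-*prime prq smoothN prp p∣Nq)
  ... | no p∤Nq = begin
      σ⊥ (suc p) (N * q)                           ≡⟨ σ⊥-coprime p∤Nq ⟩
      σ (N * q)                                    ≡⟨ σ-*prime N prq 1≤N ⟩
      σ N + σ⊥ q N * q                             ≡⟨ cong (_+ σ⊥ q N * q) (σ⊥-coprime p∤N) ⟨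
      σ⊥ (suc p) N + σ⊥ q N * q                    ≤⟨ +-mono-≤ (bound prp (smooth-∣ (m∣m*n q) smoothNq))
                                                               (*-monoˡ-≤ q (bound prq smoothN)) ⟩
      p * N + q′ * N * q                           ≤⟨ 1+o≤m⇒m*n+o*n*[1+o]≤m*[n*[1+o]] p N q≤p ⟩
      p * (N * q)                                  ∎
    where
    open ≤-Reasoning
    p∤N : ¬ suc p ∣ N
    p∤N p∣N = p∤Nq (∣-trans p∣N (m∣m*n q))
    q≤p : q ≤ p
    q≤p = s≤s⁻¹ (≤∧≢⇒< (smoothNq prq (n∣m*n N)) λ q≡p → p∤Nq (subst (_∣ N * q) q≡p (n∣m*n N)))

f≡divisorSum : ∀ n → f n ≡ divisorSum n term
f≡divisorSum n =
  trans (sum-map-filter (λ d → d ∣? n) term (map suc (upTo n))) (sum-map-upTo-suc (λ d → when (d ∣? n) (term d)) n)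

f-*prime : ∀ {q N} → Prime q → Smooth q N → 1 ≤ N → f (N * q) ≡ f N + σ⊥ q N
f-*prime {q} {N} prq smooth 1≤N = begin
  f (N * q)
    ≡⟨ f≡divisorSum (N * q) ⟩
  divisorSum (N * q) term
    ≡⟨ divisorSum-*prime N term prq 1≤N ⟩
  divisorSum N term + divisorSum⊥ q N (λ d → term (d * q))
    ≡⟨ cong₂ _+_ (sym (f≡divisorSum N)) (divisorSum⊥-cong q N term-d*q) ⟩
  f N + σ⊥ q N ∎
  where
  open ≡-Reasoning
  term-d*q : ∀ {d} → d ∣ N → ¬ d * q ∣ N → term (d * q) ≡ d
  term-d*q {zero}  0∣N _ = ⊥-elim (<⇒≢ 1≤N (sym (0∣⇒≡0 0∣N)))
  term-d*q {suc d} d∣N _ = term-*prime prq (smooth-∣ d∣N smooth) z<s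

proposition15 : ∀ (n : ℕ) → 1 ≤ n → f n ≤ n
proposition15 n = smooth-induction (λ n → f n ≤ n) ≤-refl step
  where
  step : ∀ {N q} → Prime q → Smooth q N → 1 ≤ N → f N ≤ N → f (N * q) ≤ N * q
  step {N} {q@(suc q′)} prq smooth 1≤N fN≤N = begin
    f (N * q)       ≡⟨ f-*prime prq smooth 1≤N ⟩
    f N + σ⊥ q N    ≤⟨ +-mono-≤ fN≤N (σ⊥-bound 1≤N prq smooth) ⟩
    N + q′ * N      ≡⟨ *-comm q N ⟩
    N * q           ∎
    where open ≤-Reasoning
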